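{- Let $V$ be a set with $n$ elements and let $S\subseteq V$ with $i=|S|\leq n/2$. Then the number of simple permutations $\pi$ of $V$ that invert $S$ equals $$\frac{(n-i)!}{2^{\lfloor n/2-i\rfloor}\,\lfloor n/2-i\rfloor!}.$$
   Context: A permutation of a set with $n$ elements is called simple if it is a product of $\lfloor n/2\rfloor$ disjoint cycles of length two. A permutation $\pi$ of $V$ inverts $S\subseteq V$ if $\pi(S)\cap S=\emptyset$. -}

module Defs where

open import Data.Nat using (ℕ; zero; suc; _*_; _/_)
open import Data.Nat.Properties using () renaming (_≟_ to _≟ℕ_)
open import Data.Fin using (Fin)
open import Data.Fin.Properties using (all?) renaming (_≟_ to _≟F_)
open import Data.Fin.Subset using (Subset; _∈_; _∉_; ∣_∣)
open import Data.Fin.Subset.Properties using (_∈?_)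
open import Data.Vec using (Vec; []; _∷_; lookup; tabulate)
open import Data.List using (List; [_]; map; concatMap; allFin; filter; length)
open import Data.Bool using (true; false)
open import Data.Product using (_×_)
open import Relation.Binary.PropositionalEquality using (_≡_; _≢_)
open import Relation.Nullary using (Dec; does; ¬_; ¬?)
open import Relation.Nullary.Decidable using (_×-dec_; _→-dec_)

Map : ℕ → Set
Map n = Vec (Fin n) n

tables : (n k : ℕ) → List (Vec (Fin n) k)
tables n zero    = [ [] ]
tables n (suc k) = concatMap (λ x → map (x ∷_) (tables n k)) (allFin n)

allMaps : (n : ℕ) → List (Map n)
allMaps n = tables n n

-- π ∘ π = id (then π is a permutation, being its own inverse)
IsInvolution : ∀ {n} → Map n → Set
IsInvolution π = ∀ x → lookup π (lookup π x) ≡ x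

moved : ∀ {n} → Map n → Subset n
moved π = tabulate (λ x → does (¬? (lookup π x ≟F x)))

-- π is a product of ⌊n/2⌋ disjoint 2-cycles: a permutation which is an
-- involution (product of disjoint transpositions, its 2-cycles being the
-- pairs {x, π x} with π x ≠ x) moving exactly 2·⌊n/2⌋ points
-- (i.e. having exactly ⌊n/2⌋ two-cycles).
IsSimple : ∀ {n} → Map n → Set
IsSimple {n} π = IsInvolution π × ∣ moved π ∣ ≡ 2 * (n / 2)

Inverts : ∀ {n} → Map n → Subset n → Set
Inverts π S = ∀ x → x ∈ S → lookup π x ∉ S

isSimple? : ∀ {n} (π : Map n) → Dec (IsSimple π)
isSimple? {n} π = all? (λ x → lookup π (lookup π x) ≟F x) ×-dec (∣ moved π ∣ ≟ℕ 2 * (n / 2))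

inverts? : ∀ {n} (π : Map n) (S : Subset n) → Dec (Inverts π S)
inverts? π S = all? (λ x → (x ∈? S) →-dec ¬? (lookup π x ∈? S))

numSimpleInverting : (n : ℕ) → Subset n → ℕ
numSimpleInverting n S = length (filter (λ π → isSimple? π ×-dec inverts? π S) (allMaps n))

{-# OPTIONS --safe #-}
-- If x ∈ S, an inverting simple permutation π pairs x with some y = π x outside S. Deleting x
-- turns y into a fixed point, and deleting that fixed point leaves a simple permutation of the
-- other n − 2 points inverting S ∖ {x}; both deletions can be undone. With n − i choices of y,
-- the count c(n, i) satisfies c(n, i) = (n − i) · c(n − 2, i − 1). For S = ∅ the first point is
-- either paired (n − 1 choices, then c(n − 2, 0)) or, only when n is odd, fixed (then c(n − 1, 0)).
-- Both recurrences are solved by (n − i)! / (2^(⌊n/2⌋ − i) · (⌊n/2⌋ − i)!).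
module Submission where

open import Defs
open import Data.Bool using (Bool; true; false; not)
open import Data.Bool.Properties using (T-irrelevant)
open import Data.Empty using (⊥-elim) renaming (⊥ to Empty)
open import Data.Fin using (Fin; zero; suc; punchIn; punchOut)
open import Data.Fin.Properties
  using (_≟_; all?; 1↔⊤; +↔⊎; *↔×; cantor-schröder-bernstein; punchIn-injective; punchInᵢ≢i; punchIn-punchOut)
open import Data.Fin.Subset using (Subset; inside; outside; _∈_; _∉_; ∣_∣; ⊥)
open import Data.Fin.Subset.Properties using (_∈?_; ∣p∣≤n; drop-there; ∉⊥; ∣⊥∣≡0; nonempty?; Empty-unique)
open import Data.List using (List; []; _∷_; concatMap; filter; length; _++_)
import Data.List as List
open import Data.List.Properties using (filter-++; length-++)
open import Data.Nat using (ℕ; zero; suc; _+_; _*_; _^_; _∸_; _/_; _!; _≤_; _<_; z≤n; s≤s; parity)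
open import Data.Nat.DivMod using (m/n≡1+[m∸n]/n)
open import Data.Nat.Properties
  using (+-∸-assoc; +-cancelˡ-≡; +-cancelˡ-≤; *-suc; *-assoc; <⇒≱; ≤-reflexive; ≤-trans; m≤n*m)
  renaming (_≟_ to _≟ℕ_)
open import Data.Nat.Tactic.RingSolver using (solve-∀)
open import Data.Parity.Base using (Parity; 0ℙ; 1ℙ)
open import Data.Product using (Σ; Σ-syntax; _×_; _,_; proj₁; proj₂)
open import Data.Product.Function.Dependent.Propositional using (Σ-↔)
open import Data.Product.Function.NonDependent.Propositional using (_×-↔_)
open import Data.Sum using (_⊎_; inj₁; inj₂; [_,_]; [_,_]′)
open import Data.Sum.Function.Propositional using (_⊎-↔_)
open import Data.Vec using (Vec; []; _∷_; here; there; lookup; tabulate; map; removeAt; insertAt; _[_]≔_)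
open import Data.Vec.Properties
  using ( tabulate∘lookup; tabulate-cong; lookup∘tabulate; lookup-map; []=⇒lookup; lookup⇒[]=
        ; insertAt-lookup; insertAt-punchIn; lookup∘update; lookup∘update′)
open import Function using (_∘_; id; case_of_)
open import Function.Bundles using (_↔_; mk↔ₛ′; Injection)
open import Function.Properties.Inverse using (↔-refl; ↔-sym; ↔-trans; ↔⇒↣)
open import Function.Related.Propositional using (K-reflexive)
open import Level using (0ℓ)
open import Relation.Binary.PropositionalEquality
  using (_≡_; _≢_; refl; sym; trans; cong; cong₂; subst; module ≡-Reasoning)
open import Relation.Nullary using (yes; no; does; ¬_; ¬?)
open import Relation.Nullary.Decidable using (True; toWitness; fromWitness; _×-dec_; dec-true; dec-false)
open import Relation.Unary using (Pred; Decidable)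

private variable
  A B : Set
  P : Pred A 0ℓ
  m n k : ℕ

infixr 2 _⟨↔⟩_
_⟨↔⟩_ : {A B C : Set} → A ↔ B → B ↔ C → A ↔ C
_⟨↔⟩_ = ↔-trans

Fin-cong : m ≡ n → Fin m ↔ Fin n
Fin-cong = K-reflexive ∘ cong Fin

Fin-injective : Fin m ↔ Fin n → m ≡ n
Fin-injective f = cantor-schröder-bernstein (Injection.injective (↔⇒↣ f)) (Injection.injective (↔⇒↣ (↔-sym f)))

⊎-cancelˡ-empty : ¬ A → (A ⊎ B) ↔ B
⊎-cancelˡ-empty ¬a = mk↔ₛ′ [ ⊥-elim ∘ ¬a , id ]′ inj₂ (λ _ → refl) [ ⊥-elim ∘ ¬a , (λ _ → refl) ]

Σ-Fin-zero : {B : Fin 0 → Set} → Σ (Fin 0) B ↔ Fin 0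
Σ-Fin-zero = mk↔ₛ′ (λ ()) (λ ()) (λ ()) (λ ())

Σ-Fin-suc : {B : Fin (suc n) → Set} → Σ (Fin (suc n)) B ↔ (B zero ⊎ Σ[ j ∈ Fin n ] B (suc j))
Σ-Fin-suc = mk↔ₛ′
  (λ { (zero , b) → inj₁ b ; (suc j , b) → inj₂ (j , b) })
  (λ { (inj₁ b) → zero , b ; (inj₂ (j , b)) → suc j , b })
  (λ { (inj₁ b) → refl ; (inj₂ (j , b)) → refl })
  (λ { (zero , b) → refl ; (suc j , b) → refl })

-- Membership is witnessed by the proof-irrelevant `True (P? a)`, so an element is determined by
-- its first component.
Subtype : {P : Pred A 0ℓ} → Decidable P → Set
Subtype {A = A} P? = Σ[ a ∈ A ] True (P? a)

Subtype-≡ : {P? : Decidable P} {u v : Subtype P?} → proj₁ u ≡ proj₁ v → u ≡ v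
Subtype-≡ {u = a , p} {v = .a , q} refl = cong (a ,_) (T-irrelevant p q)

Subtype-↔ : {P : Pred A 0ℓ} {Q : Pred B 0ℓ} (P? : Decidable P) (Q? : Decidable Q)
  (f : ∀ a → P a → B) (g : ∀ b → Q b → A) → (∀ a p → Q (f a p)) → (∀ b q → P (g b q)) →
  (∀ b q p → f (g b q) p ≡ b) → (∀ a p q → g (f a p) q ≡ a) → Subtype P? ↔ Subtype Q?
Subtype-↔ P? Q? f g fQ gP fg gf = mk↔ₛ′
  (λ (a , p) → f a (toWitness p) , fromWitness (fQ a (toWitness p)))
  (λ (b , q) → g b (toWitness q) , fromWitness (gP b (toWitness q)))
  (λ (b , q) → Subtype-≡ {P? = Q?} (fg b (toWitness q) _))
  (λ (a , p) → Subtype-≡ {P? = P?} (gf a (toWitness p) _))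

Subtype-⇔ : {P Q : Pred A 0ℓ} (P? : Decidable P) (Q? : Decidable Q) →
  (∀ a → P a → Q a) → (∀ a → Q a → P a) → Subtype P? ↔ Subtype Q?
Subtype-⇔ P? Q? pq qp =
  Subtype-↔ P? Q? (λ a _ → a) (λ b _ → b) pq qp (λ _ _ _ → refl) (λ _ _ _ → refl)

Subtype-split : {P C : Pred A 0ℓ} (P? : Decidable P) (C? : Decidable C) →
  Subtype P? ↔ (Subtype (λ a → P? a ×-dec ¬? (C? a)) ⊎ Subtype (λ a → P? a ×-dec C? a))
Subtype-split {A = A} P? C? = mk↔ₛ′ split join split∘join join∘split
  where
  split : Subtype P? → Subtype (λ a → P? a ×-dec ¬? (C? a)) ⊎ Subtype (λ a → P? a ×-dec C? a)
  split (a , p) with C? a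
  ... | yes c = inj₂ (a , fromWitness (toWitness p , c))
  ... | no ¬c = inj₁ (a , fromWitness (toWitness p , ¬c))
  join : Subtype (λ a → P? a ×-dec ¬? (C? a)) ⊎ Subtype (λ a → P? a ×-dec C? a) → Subtype P?
  join (inj₁ (a , p)) = a , fromWitness (proj₁ (toWitness p))
  join (inj₂ (a , p)) = a , fromWitness (proj₁ (toWitness p))
  split∘join : ∀ s → split (join s) ≡ s
  split∘join (inj₁ (a , p)) with C? a | toWitness p
  ... | yes c | (_ , ¬c) = ⊥-elim (¬c c)
  ... | no _  | _        = cong inj₁ (Subtype-≡ refl)
  split∘join (inj₂ (a , p)) with C? a | toWitness p
  ... | yes _ | _        = cong inj₂ (Subtype-≡ refl)
  ... | no ¬c | (_ , c)  = ⊥-elim (¬c c)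
  join∘split : ∀ s → join (split s) ≡ s
  join∘split (a , p) with C? a
  ... | yes _ = Subtype-≡ refl
  ... | no _  = Subtype-≡ refl

Subtype-Σ : {C : Pred A 0ℓ} {D : A → Pred B 0ℓ} (C? : Decidable C) (D? : ∀ a → Decidable (D a)) →
  Subtype {A = A × B} (λ (a , b) → C? a ×-dec D? a b) ↔ (Σ[ c ∈ Subtype C? ] Subtype (D? (proj₁ c)))
Subtype-Σ C? D? = mk↔ₛ′
  (λ ((a , b) , p) → (a , fromWitness (proj₁ (toWitness p))) , (b , fromWitness (proj₂ (toWitness p))))
  (λ ((a , c) , (b , d)) → (a , b) , fromWitness (toWitness c , toWitness d))
  (λ ((a , c) , (b , d)) → cong₂ (λ c′ d′ → (a , c′) , (b , d′)) (T-irrelevant _ _) (T-irrelevant _ _))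
  (λ ((a , b) , p) → cong ((a , b) ,_) (T-irrelevant _ _))

Subtype-empty : {P : Pred A 0ℓ} (P? : Decidable P) → (∀ a → ¬ P a) → Subtype P? ↔ Fin 0
Subtype-empty P? ¬P = mk↔ₛ′ (⊥-elim ∘ absurd) (λ ()) (λ ()) (⊥-elim ∘ absurd)
  where
  absurd : Subtype P? → Empty
  absurd (a , p) = ¬P a (toWitness p)

Subtype-unique : {P : Pred A 0ℓ} (P? : Decidable P) (a : A) → P a → (∀ b → b ≡ a) → Subtype P? ↔ Fin 1
Subtype-unique P? a pa unique =
  mk↔ₛ′ (λ _ → zero) (λ _ → a , fromWitness pa) (λ { zero → refl }) (λ (b , _) → Subtype-≡ (sym (unique b)))

length-filter-map : {P : Pred B 0ℓ} (P? : Decidable P) (f : A → B) (xs : List A) →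
  length (filter P? (List.map f xs)) ≡ length (filter (P? ∘ f) xs)
length-filter-map P? f [] = refl
length-filter-map P? f (x ∷ xs) with does (P? (f x))
... | true  = cong suc (length-filter-map P? f xs)
... | false = length-filter-map P? f xs

Fin-length-filter-++ : {P : Pred A 0ℓ} (P? : Decidable P) (xs ys : List A) →
  Fin (length (filter P? (xs ++ ys))) ↔ (Fin (length (filter P? xs)) ⊎ Fin (length (filter P? ys)))
Fin-length-filter-++ P? xs ys =
  Fin-cong (trans (cong length (filter-++ P? xs ys)) (length-++ (filter P? xs))) ⟨↔⟩ +↔⊎

-- `allFin n` is `List.tabulate id`; generalising `id` to `h` is what makes the induction go through.
count-tables : ∀ n k {P : Pred (Vec (Fin n) k) 0ℓ} (P? : Decidable P) →
  Fin (length (filter P? (tables n k))) ↔ Subtype P?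
count-tables-from : ∀ n k m (h : Fin m → Fin n) {P : Pred (Vec (Fin n) (suc k)) 0ℓ} (P? : Decidable P) →
  Fin (length (filter P? (concatMap (λ x → List.map (x ∷_) (tables n k)) (List.tabulate h))))
    ↔ (Σ[ j ∈ Fin m ] Subtype (λ v → P? (h j ∷ v)))

count-tables n zero P? with P? []
... | yes p = mk↔ₛ′ (λ _ → [] , fromWitness p) (λ _ → zero) (λ { ([] , _) → Subtype-≡ refl }) (λ { zero → refl })
... | no ¬p = ↔-sym (Subtype-empty P? λ { [] → ¬p })
count-tables n (suc k) P? = count-tables-from n k n id P? ⟨↔⟩ mk↔ₛ′
  (λ (j , v , p) → (j ∷ v) , p) (λ { ((j ∷ v) , p) → j , v , p })
  (λ { ((j ∷ v) , p) → refl }) (λ { (j , v , p) → refl })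

count-tables-from n k zero h P? = ↔-sym Σ-Fin-zero
count-tables-from n k (suc m) h P? =
  Fin-length-filter-++ P? (List.map (h zero ∷_) (tables n k)) _
  ⟨↔⟩ ((Fin-cong (length-filter-map P? (h zero ∷_) (tables n k)) ⟨↔⟩ count-tables n k (λ v → P? (h zero ∷ v)))
       ⊎-↔ count-tables-from n k m (h ∘ suc) P?)
  ⟨↔⟩ ↔-sym Σ-Fin-suc

lookup-ext : {xs ys : Vec A n} → (∀ i → lookup xs i ≡ lookup ys i) → xs ≡ ys
lookup-ext {xs = xs} {ys} eq = trans (sym (tabulate∘lookup xs)) (trans (tabulate-cong eq) (tabulate∘lookup ys))

removeAt-punchIn : (xs : Vec A (suc n)) (i : Fin (suc n)) (j : Fin n) →
  lookup (removeAt xs i) j ≡ lookup xs (punchIn i j)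
removeAt-punchIn (x ∷ xs)     zero    j       = refl
removeAt-punchIn (x ∷ y ∷ xs) (suc i) zero    = refl
removeAt-punchIn (x ∷ y ∷ xs) (suc i) (suc j) = removeAt-punchIn (y ∷ xs) i j

∈-removeAt⁺ : {p : Subset (suc n)} {x : Fin (suc n)} {z : Fin n} → punchIn x z ∈ p → z ∈ removeAt p x
∈-removeAt⁺ {p = p} {x} {z} pxz∈p = lookup⇒[]= z _ (trans (removeAt-punchIn p x z) ([]=⇒lookup pxz∈p))

∈-removeAt⁻ : {p : Subset (suc n)} {x : Fin (suc n)} {z : Fin n} → z ∈ removeAt p x → punchIn x z ∈ p
∈-removeAt⁻ {p = p} {x} {z} z∈ = lookup⇒[]= (punchIn x z) p (trans (sym (removeAt-punchIn p x z)) ([]=⇒lookup z∈))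

∣removeAt∣-∈ : {p : Subset (suc n)} {x : Fin (suc n)} → x ∈ p → ∣ p ∣ ≡ suc ∣ removeAt p x ∣
∣removeAt∣-∈ here = refl
∣removeAt∣-∈ {p = outside ∷ _ ∷ _} (there x∈p) = ∣removeAt∣-∈ x∈p
∣removeAt∣-∈ {p = inside  ∷ _ ∷ _} (there x∈p) = cong suc (∣removeAt∣-∈ x∈p)

∣removeAt∣-∉ : {p : Subset (suc n)} {x : Fin (suc n)} → x ∉ p → ∣ p ∣ ≡ ∣ removeAt p x ∣
∣removeAt∣-∉ {p = inside  ∷ _}     {zero}  x∉p = ⊥-elim (x∉p here)
∣removeAt∣-∉ {p = outside ∷ _}     {zero}  x∉p = refl
∣removeAt∣-∉ {p = outside ∷ _ ∷ _} {suc x} x∉p = ∣removeAt∣-∉ (x∉p ∘ there)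
∣removeAt∣-∉ {p = inside  ∷ _ ∷ _} {suc x} x∉p = cong suc (∣removeAt∣-∉ (x∉p ∘ there))

removeAt-⊥ : (x : Fin (suc n)) → removeAt (⊥ {suc n}) x ≡ ⊥
removeAt-⊥ zero = refl
removeAt-⊥ {suc n} (suc x) = cong (outside ∷_) (removeAt-⊥ x)

∉-there : {b : Bool} {p : Subset n} → Subtype (λ y → ¬? (suc y ∈? (b ∷ p))) ↔ Subtype (λ y → ¬? (y ∈? p))
∉-there = Subtype-⇔ _ _ (λ _ → _∘ there) (λ _ → _∘ drop-there)

∁-count : (p : Subset n) → Subtype (λ y → ¬? (y ∈? p)) ↔ Fin (n ∸ ∣ p ∣)
∁-count [] = Σ-Fin-zero
∁-count (inside ∷ p) = Σ-Fin-suc ⟨↔⟩ ⊎-cancelˡ-empty (λ ()) ⟨↔⟩ ∉-there ⟨↔⟩ ∁-count p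
∁-count {suc n} (outside ∷ p) =
  Σ-Fin-suc ⟨↔⟩ (↔-sym 1↔⊤ ⊎-↔ (∉-there ⟨↔⟩ ∁-count p)) ⟨↔⟩ ↔-sym +↔⊎ ⟨↔⟩ Fin-cong (sym (+-∸-assoc 1 (∣p∣≤n p)))

data PunchView (x : Fin (suc n)) : Fin (suc n) → Set where
  at      : PunchView x x
  punched : (z : Fin n) → PunchView x (punchIn x z)

punchView : (x w : Fin (suc n)) → PunchView x w
punchView x w with x ≟ w
... | yes refl = at
... | no x≢w   = subst (PunchView x) (punchIn-punchOut x≢w) (punched (punchOut x≢w))

x≢punchIn : (x : Fin (suc n)) (z : Fin n) → x ≢ punchIn x z
x≢punchIn x z = punchInᵢ≢i x z ∘ sym

does-punchIn-≟ : (x : Fin (suc n)) (a b : Fin n) → does (punchIn x a ≟ punchIn x b) ≡ does (a ≟ b)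
does-punchIn-≟ x a b with a ≟ b
... | yes refl = dec-true (punchIn x a ≟ punchIn x a) refl
... | no a≢b   = dec-false (punchIn x a ≟ punchIn x b) (a≢b ∘ punchIn-injective x a b)

lookup-moved : (π : Map n) (w : Fin n) → lookup (moved π) w ≡ not (does (lookup π w ≟ w))
lookup-moved π = lookup∘tabulate _

∈-moved⁺ : {π : Map n} {w : Fin n} → lookup π w ≢ w → w ∈ moved π
∈-moved⁺ {π = π} {w} πw≢w = lookup⇒[]= w (moved π) (trans (lookup-moved π w) (cong not (dec-false (lookup π w ≟ w) πw≢w)))

∉-moved⁺ : {π : Map n} {w : Fin n} → lookup π w ≡ w → w ∉ moved π
∉-moved⁺ {π = π} {w} πw≡w w∈ =
  case trans (sym ([]=⇒lookup w∈)) (trans (lookup-moved π w) (cong not (dec-true (lookup π w ≟ w) πw≡w))) of λ ()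

moved-punchIn : {π : Map (suc n)} {σ : Map n} {x : Fin (suc n)} {z : Fin n} →
  lookup π (punchIn x z) ≡ punchIn x (lookup σ z) → lookup (moved π) (punchIn x z) ≡ lookup (moved σ) z
moved-punchIn {π = π} {σ} {x} {z} eq = begin
  lookup (moved π) (punchIn x z)                      ≡⟨ lookup-moved π (punchIn x z) ⟩
  not (does (lookup π (punchIn x z) ≟ punchIn x z))  ≡⟨ cong (λ w → not (does (w ≟ punchIn x z))) eq ⟩
  not (does (punchIn x (lookup σ z) ≟ punchIn x z))  ≡⟨ cong not (does-punchIn-≟ x (lookup σ z) z) ⟩
  not (does (lookup σ z ≟ z))                         ≡⟨ lookup-moved σ z ⟨
  lookup (moved σ) z                                  ∎
  where open ≡-Reasoning

insertFixed : Fin (suc n) → Map n → Map (suc n)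
insertFixed x σ = insertAt (map (punchIn x) σ) x x

insertTransposition : Fin (suc n) → Fin n → Map n → Map (suc n)
insertTransposition x y ρ = insertAt (map (punchIn x) ρ [ y ]≔ x) x (punchIn x y)

redirect : Fin (suc n) → Fin (suc n) → Fin n → Fin n
redirect x w z with x ≟ w
... | yes _   = z
... | no x≢w = punchOut x≢w

-- Deletes the point x; if x was moved, its partner becomes a fixed point.
contract : Fin (suc n) → Map (suc n) → Map n
contract x π = tabulate λ z → redirect x (lookup π (punchIn x z)) z

lookup-contract : (x : Fin (suc n)) (π : Map (suc n)) (z : Fin n) →
  lookup (contract x π) z ≡ redirect x (lookup π (punchIn x z)) z
lookup-contract x π = lookup∘tabulate _

redirect-self : (x : Fin (suc n)) (z : Fin n) → redirect x x z ≡ z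
redirect-self x z with x ≟ x
... | yes _   = refl
... | no x≢x = ⊥-elim (x≢x refl)

punchIn-redirect : {x w : Fin (suc n)} (z : Fin n) → x ≢ w → punchIn x (redirect x w z) ≡ w
punchIn-redirect {x = x} {w} z x≢w with x ≟ w
... | yes x≡w  = ⊥-elim (x≢w x≡w)
... | no x≢w′ = punchIn-punchOut x≢w′

record InsertsFixedPoint (x : Fin (suc n)) (σ : Map n) (π : Map (suc n)) : Set where
  constructor insertsFixedPoint
  field
    fixes  : lookup π x ≡ x
    agrees : ∀ z → lookup π (punchIn x z) ≡ punchIn x (lookup σ z)

module FixedPointInsertion {x : Fin (suc n)} {σ : Map n} {π : Map (suc n)} (r : InsertsFixedPoint x σ π) where
  open InsertsFixedPoint r

  determines-π : ∀ {π′} → InsertsFixedPoint x σ π′ → π ≡ π′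
  determines-π {π′} (insertsFixedPoint fixes′ agrees′) = lookup-ext pointwise
    where
    pointwise : ∀ w → lookup π w ≡ lookup π′ w
    pointwise w with punchView x w
    ... | at        = trans fixes (sym fixes′)
    ... | punched z = trans (agrees z) (sym (agrees′ z))

  determines-σ : ∀ {σ′} → InsertsFixedPoint x σ′ π → σ ≡ σ′
  determines-σ (insertsFixedPoint _ agrees′) =
    lookup-ext λ z → punchIn-injective x _ _ (trans (sym (agrees z)) (agrees′ z))

  involution⁺ : IsInvolution π → IsInvolution σ
  involution⁺ inv z = punchIn-injective x _ _ (begin
    punchIn x (lookup σ (lookup σ z))  ≡⟨ agrees (lookup σ z) ⟨
    lookup π (punchIn x (lookup σ z))  ≡⟨ cong (lookup π) (agrees z) ⟨
    lookup π (lookup π (punchIn x z))  ≡⟨ inv (punchIn x z) ⟩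
    punchIn x z                         ∎)
    where open ≡-Reasoning

  involution⁻ : IsInvolution σ → IsInvolution π
  involution⁻ inv w with punchView x w
  ... | at        = trans (cong (lookup π) fixes) fixes
  ... | punched z = trans (cong (lookup π) (agrees z)) (trans (agrees (lookup σ z)) (cong (punchIn x) (inv z)))

  moved-count : ∣ moved π ∣ ≡ ∣ moved σ ∣
  moved-count = trans (∣removeAt∣-∉ (∉-moved⁺ {π = π} fixes)) (cong ∣_∣ removeAt-moved)
    where
    removeAt-moved : removeAt (moved π) x ≡ moved σ
    removeAt-moved = lookup-ext λ z → trans (removeAt-punchIn (moved π) x z) (moved-punchIn {π = π} {σ} (agrees z))

  inverts⁺ : ∀ {S} → Inverts π S → Inverts σ (removeAt S x)
  inverts⁺ {S} inv z z∈ σz∈ = inv (punchIn x z) (∈-removeAt⁻ z∈) (subst (_∈ S) (sym (agrees z)) (∈-removeAt⁻ σz∈))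

  inverts⁻ : ∀ {S} → x ∉ S → Inverts σ (removeAt S x) → Inverts π S
  inverts⁻ x∉S inv w w∈ πw∈ with punchView x w
  ... | at        = x∉S w∈
  ... | punched z = inv z (∈-removeAt⁺ w∈) (∈-removeAt⁺ (subst (_∈ _) (agrees z) πw∈))

insertFixed-inserts : (x : Fin (suc n)) (σ : Map n) → InsertsFixedPoint x σ (insertFixed x σ)
insertFixed-inserts x σ = record
  { fixes  = insertAt-lookup (map (punchIn x) σ) x x
  ; agrees = λ z → trans (insertAt-punchIn (map (punchIn x) σ) x x z) (lookup-map z (punchIn x) σ)
  }

contract-fixed : {x : Fin (suc n)} (π : Map (suc n)) → IsInvolution π → lookup π x ≡ x →
  InsertsFixedPoint x (contract x π) π
contract-fixed {x = x} π inv πx≡x = record { fixes = πx≡x ; agrees = agrees }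
  where
  agrees : ∀ z → lookup π (punchIn x z) ≡ punchIn x (lookup (contract x π) z)
  agrees z = sym (trans (cong (punchIn x) (lookup-contract x π z)) (punchIn-redirect z x≢π[z′]))
    where
    x≢π[z′] : x ≢ lookup π (punchIn x z)
    x≢π[z′] x≡ = x≢punchIn x z (trans (sym πx≡x) (trans (cong (lookup π) x≡) (inv (punchIn x z))))

record InsertsTransposition (x : Fin (suc (suc n))) (y : Fin (suc n)) (ρ : Map (suc n)) (π : Map (suc (suc n))) : Set where
  constructor insertsTransposition
  field
    sends-x : lookup π x ≡ punchIn x y
    sends-y : lookup π (punchIn x y) ≡ x
    fixes-y : lookup ρ y ≡ y
    agrees  : ∀ z → z ≢ y → lookup π (punchIn x z) ≡ punchIn x (lookup ρ z)

module TranspositionInsertion {x : Fin (suc (suc n))} {y : Fin (suc n)} {ρ : Map (suc n)} {π : Map (suc (suc n))}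
                              (r : InsertsTransposition x y ρ π) where
  open InsertsTransposition r

  determines-π : ∀ {π′} → InsertsTransposition x y ρ π′ → π ≡ π′
  determines-π {π′} (insertsTransposition sends-x′ sends-y′ _ agrees′) = lookup-ext pointwise
    where
    pointwise : ∀ w → lookup π w ≡ lookup π′ w
    pointwise w with punchView x w
    ... | at = trans sends-x (sym sends-x′)
    ... | punched z with z ≟ y
    ...   | yes refl = trans sends-y (sym sends-y′)
    ...   | no z≢y   = trans (agrees z z≢y) (sym (agrees′ z z≢y))

  determines-ρ : ∀ {ρ′} → InsertsTransposition x y ρ′ π → ρ ≡ ρ′
  determines-ρ {ρ′} (insertsTransposition _ _ fixes-y′ agrees′) = lookup-ext pointwise
    where
    pointwise : ∀ z → lookup ρ z ≡ lookup ρ′ z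
    pointwise z with z ≟ y
    ... | yes refl = trans fixes-y (sym fixes-y′)
    ... | no z≢y   = punchIn-injective x _ _ (trans (sym (agrees z z≢y)) (agrees′ z z≢y))

  determines-yρ : ∀ {y′ ρ′} → InsertsTransposition x y′ ρ′ π → (y , ρ) ≡ (y′ , ρ′)
  determines-yρ r′ with punchIn-injective x y _ (trans (sym sends-x) (InsertsTransposition.sends-x r′))
  ... | refl = cong (y ,_) (determines-ρ r′)

  involution⁺ : IsInvolution π → IsInvolution ρ
  involution⁺ inv z with z ≟ y
  ... | yes refl = trans (cong (lookup ρ) fixes-y) fixes-y
  ... | no z≢y with lookup ρ z ≟ y
  ...   | yes ρz≡y = ⊥-elim (x≢punchIn x z (begin
    x                                  ≡⟨ sends-y ⟨
    lookup π (punchIn x y)             ≡⟨ cong (lookup π ∘ punchIn x) ρz≡y ⟨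
    lookup π (punchIn x (lookup ρ z))  ≡⟨ cong (lookup π) (agrees z z≢y) ⟨
    lookup π (lookup π (punchIn x z))  ≡⟨ inv (punchIn x z) ⟩
    punchIn x z                        ∎))
    where open ≡-Reasoning
  ...   | no ρz≢y = punchIn-injective x _ _ (begin
    punchIn x (lookup ρ (lookup ρ z))  ≡⟨ agrees (lookup ρ z) ρz≢y ⟨
    lookup π (punchIn x (lookup ρ z))  ≡⟨ cong (lookup π) (agrees z z≢y) ⟨
    lookup π (lookup π (punchIn x z))  ≡⟨ inv (punchIn x z) ⟩
    punchIn x z                        ∎)
    where open ≡-Reasoning

  involution⁻ : IsInvolution ρ → IsInvolution π
  involution⁻ inv w with punchView x w
  ... | at = trans (cong (lookup π) sends-x) sends-y
  ... | punched z with z ≟ y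
  ...   | yes refl = trans (cong (lookup π) sends-y) sends-x
  ...   | no z≢y with lookup ρ z ≟ y
  ...     | yes ρz≡y = ⊥-elim (z≢y (trans (sym (inv z)) (trans (cong (lookup ρ) ρz≡y) fixes-y)))
  ...     | no ρz≢y  = trans (cong (lookup π) (agrees z z≢y))
                         (trans (agrees (lookup ρ z) ρz≢y) (cong (punchIn x) (inv z)))

  moved-count : ∣ moved π ∣ ≡ 2 + ∣ moved ρ ∣
  moved-count = begin
    ∣ moved π ∣                                ≡⟨ ∣removeAt∣-∈ (∈-moved⁺ {π = π} x-moved) ⟩
    suc ∣ removeAt (moved π) x ∣               ≡⟨ cong suc (∣removeAt∣-∈ (∈-removeAt⁺ (∈-moved⁺ {π = π} y-moved))) ⟩
    2 + ∣ removeAt (removeAt (moved π) x) y ∣  ≡⟨ cong (λ p → 2 + ∣ p ∣) removeAt-moved ⟩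
    2 + ∣ removeAt (moved ρ) y ∣               ≡⟨ cong (2 +_) (∣removeAt∣-∉ (∉-moved⁺ {π = ρ} fixes-y)) ⟨
    2 + ∣ moved ρ ∣                            ∎
    where
    open ≡-Reasoning
    x-moved : lookup π x ≢ x
    x-moved = x≢punchIn x y ∘ sym ∘ trans (sym sends-x)
    y-moved : lookup π (punchIn x y) ≢ punchIn x y
    y-moved = x≢punchIn x y ∘ trans (sym sends-y)
    removeAt-moved : removeAt (removeAt (moved π) x) y ≡ removeAt (moved ρ) y
    removeAt-moved = lookup-ext λ u → begin
      lookup (removeAt (removeAt (moved π) x) y) u  ≡⟨ removeAt-punchIn (removeAt (moved π) x) y u ⟩
      lookup (removeAt (moved π) x) (punchIn y u)   ≡⟨ removeAt-punchIn (moved π) x (punchIn y u) ⟩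
      lookup (moved π) (punchIn x (punchIn y u))    ≡⟨ moved-punchIn {π = π} {ρ} (agrees _ (punchInᵢ≢i y u)) ⟩
      lookup (moved ρ) (punchIn y u)                ≡⟨ removeAt-punchIn (moved ρ) y u ⟨
      lookup (removeAt (moved ρ) y) u               ∎

  inverts⁺ : ∀ {S} → punchIn x y ∉ S → Inverts π S → Inverts ρ (removeAt S x)
  inverts⁺ {S} y′∉S inv z z∈ ρz∈ with z ≟ y
  ... | yes refl = y′∉S (∈-removeAt⁻ z∈)
  ... | no z≢y   = inv (punchIn x z) (∈-removeAt⁻ z∈) (subst (_∈ S) (sym (agrees z z≢y)) (∈-removeAt⁻ ρz∈))

  inverts⁻ : ∀ {S} → punchIn x y ∉ S → Inverts ρ (removeAt S x) → Inverts π S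
  inverts⁻ {S} y′∉S inv w w∈ πw∈ with punchView x w
  ... | at = y′∉S (subst (_∈ S) sends-x πw∈)
  ... | punched z with z ≟ y
  ...   | yes refl = y′∉S w∈
  ...   | no z≢y   = inv z (∈-removeAt⁺ w∈) (∈-removeAt⁺ (subst (_∈ S) (agrees z z≢y) πw∈))

insertTransposition-inserts : (x : Fin (suc (suc n))) {y : Fin (suc n)} {ρ : Map (suc n)} → lookup ρ y ≡ y →
  InsertsTransposition x y ρ (insertTransposition x y ρ)
insertTransposition-inserts x {y} {ρ} ρy≡y = record
  { sends-x = insertAt-lookup ρ′ x (punchIn x y)
  ; sends-y = trans (insertAt-punchIn ρ′ x (punchIn x y) y) (lookup∘update y (map (punchIn x) ρ) x)
  ; fixes-y = ρy≡y
  ; agrees  = λ z z≢y → begin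
      lookup (insertTransposition x y ρ) (punchIn x z)  ≡⟨ insertAt-punchIn ρ′ x (punchIn x y) z ⟩
      lookup ρ′ z                                       ≡⟨ lookup∘update′ z≢y (map (punchIn x) ρ) x ⟩
      lookup (map (punchIn x) ρ) z                      ≡⟨ lookup-map z (punchIn x) ρ ⟩
      punchIn x (lookup ρ z)                            ∎
  }
  where
  open ≡-Reasoning
  ρ′ = map (punchIn x) ρ [ y ]≔ x

contract-transposition : {x : Fin (suc (suc n))} (π : Map (suc (suc n))) → IsInvolution π → (x≢πx : x ≢ lookup π x) →
  InsertsTransposition x (punchOut x≢πx) (contract x π) π
contract-transposition {x = x} π inv x≢πx = record
  { sends-x = sym y′≡πx
  ; sends-y = sends-y
  ; fixes-y = trans (lookup-contract x π y) (trans (cong (λ w → redirect x w y) sends-y) (redirect-self x y))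
  ; agrees  = λ z z≢y → sym (trans (cong (punchIn x) (lookup-contract x π z)) (punchIn-redirect z (x≢π[z′] z z≢y)))
  }
  where
  y = punchOut x≢πx
  y′≡πx : punchIn x y ≡ lookup π x
  y′≡πx = punchIn-punchOut x≢πx
  sends-y : lookup π (punchIn x y) ≡ x
  sends-y = trans (cong (lookup π) y′≡πx) (inv x)
  x≢π[z′] : ∀ z → z ≢ y → x ≢ lookup π (punchIn x z)
  x≢π[z′] z z≢y x≡ = z≢y (punchIn-injective x z y (begin
    punchIn x z                        ≡⟨ inv (punchIn x z) ⟨
    lookup π (lookup π (punchIn x z))  ≡⟨ cong (lookup π) x≡ ⟨
    lookup π x                         ≡⟨ y′≡πx ⟨
    punchIn x y                        ∎))
    where open ≡-Reasoning

-- For k = 2 * (n / 2), `involutionInverting? k S` is definitionally the filter in `numSimpleInverting n S`.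
InvolutionInverting : ℕ → Subset n → Map n → Set
InvolutionInverting k S π = (IsInvolution π × ∣ moved π ∣ ≡ k) × Inverts π S

involutionInverting? : (k : ℕ) (S : Subset n) → Decidable (InvolutionInverting k S)
involutionInverting? k S π = (all? (λ x → lookup π (lookup π x) ≟ x) ×-dec (∣ moved π ∣ ≟ℕ k)) ×-dec inverts? π S

Involutions : ℕ → Subset n → Set
Involutions k S = Subtype (involutionInverting? k S)

Involutions-empty : {S : Subset n} → n < k → Involutions k S ↔ Fin 0
Involutions-empty n<k = Subtype-empty _ λ π ((_ , mv) , _) → <⇒≱ n<k (subst (_≤ _) mv (∣p∣≤n (moved π)))

remove-fixed-point : (x : Fin (suc n)) {S : Subset (suc n)} → x ∉ S →
  Subtype (λ π → involutionInverting? k S π ×-dec (lookup π x ≟ x)) ↔ Involutions k (removeAt S x)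
remove-fixed-point {k = k} x {S} x∉S =
  Subtype-↔ _ _ (λ π _ → contract x π) (λ σ _ → insertFixed x σ) forth back forth∘back back∘forth
  where
  forth : ∀ π → InvolutionInverting k S π × lookup π x ≡ x → InvolutionInverting k (removeAt S x) (contract x π)
  forth π (((inv , mv) , inverts) , πx≡x) = (involution⁺ inv , trans (sym moved-count) mv) , inverts⁺ inverts
    where open FixedPointInsertion (contract-fixed π inv πx≡x)
  back : ∀ σ → InvolutionInverting k (removeAt S x) σ →
         InvolutionInverting k S (insertFixed x σ) × lookup (insertFixed x σ) x ≡ x
  back σ ((inv , mv) , inverts) = ((involution⁻ inv , trans moved-count mv) , inverts⁻ x∉S inverts) , fixes
    where
    open InsertsFixedPoint (insertFixed-inserts x σ)
    open FixedPointInsertion (insertFixed-inserts x σ)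
  forth∘back : ∀ σ _ → (p : InvolutionInverting k S (insertFixed x σ) × _) → contract x (insertFixed x σ) ≡ σ
  forth∘back σ _ (((inv , _) , _) , fix) =
    FixedPointInsertion.determines-σ (contract-fixed _ inv fix) (insertFixed-inserts x σ)
  back∘forth : ∀ π (p : InvolutionInverting k S π × _) _ → insertFixed x (contract x π) ≡ π
  back∘forth π (((inv , _) , _) , fix) _ =
    FixedPointInsertion.determines-π (insertFixed-inserts x (contract x π)) (contract-fixed _ inv fix)

remove-moved-point : (x : Fin (suc (suc n))) {S : Subset (suc (suc n))} → (∀ π → Inverts π S → lookup π x ∉ S) →
  Subtype (λ π → involutionInverting? (2 + k) S π ×-dec ¬? (lookup π x ≟ x))
    ↔ (Σ[ y ∈ Subtype (λ y → ¬? (y ∈? removeAt S x)) ]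
         Subtype (λ ρ → involutionInverting? k (removeAt S x) ρ ×-dec (lookup ρ (proj₁ y) ≟ proj₁ y)))
remove-moved-point {n = n} {k = k} x {S} πx∉S =
  Subtype-↔ _ (λ (y , ρ) → ¬? (y ∈? S′) ×-dec (involutionInverting? k S′ ρ ×-dec (lookup ρ y ≟ y)))
    (λ π (_ , ¬fix) → punchOut (¬fix ∘ sym) , contract x π) (λ (y , ρ) _ → insertTransposition x y ρ)
    forth back forth∘back back∘forth
  ⟨↔⟩ Subtype-Σ _ _
  where
  S′ = removeAt S x
  forth : ∀ π (p : InvolutionInverting (2 + k) S π × lookup π x ≢ x) →
          let y = punchOut (proj₂ p ∘ sym) in
          y ∉ S′ × InvolutionInverting k S′ (contract x π) × lookup (contract x π) y ≡ y
  forth π (((inv , mv) , inverts) , ¬fix) =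
    y′∉S ∘ ∈-removeAt⁻ ,
    ((involution⁺ inv , +-cancelˡ-≡ 2 _ _ (trans (sym moved-count) mv)) , inverts⁺ y′∉S inverts) , fixes-y
    where
    r = contract-transposition π inv (¬fix ∘ sym)
    open InsertsTransposition r
    open TranspositionInsertion r
    y′∉S : punchIn x (punchOut (¬fix ∘ sym)) ∉ S
    y′∉S = πx∉S π inverts ∘ subst (_∈ S) (sym sends-x)
  back : ∀ ((y , ρ) : Fin (suc n) × Map (suc n)) → y ∉ S′ × InvolutionInverting k S′ ρ × lookup ρ y ≡ y →
         InvolutionInverting (2 + k) S (insertTransposition x y ρ) × lookup (insertTransposition x y ρ) x ≢ x
  back (y , ρ) (y∉S′ , ((inv , mv) , inverts) , fix) =
    ((involution⁻ inv , trans moved-count (cong (2 +_) mv)) , inverts⁻ (y∉S′ ∘ ∈-removeAt⁺) inverts) ,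
    λ πx≡x → x≢punchIn x y (trans (sym πx≡x) sends-x)
    where
    r = insertTransposition-inserts x fix
    open InsertsTransposition r
    open TranspositionInsertion r
  forth∘back : ∀ yρ q p → (punchOut (proj₂ p ∘ sym) , contract x (insertTransposition x (proj₁ yρ) (proj₂ yρ))) ≡ yρ
  forth∘back (y , ρ) (_ , _ , fix) (((inv , _) , _) , ¬fix) =
    TranspositionInsertion.determines-yρ
      (contract-transposition _ inv (¬fix ∘ sym)) (insertTransposition-inserts x fix)
  back∘forth : ∀ π p q → insertTransposition x (punchOut (proj₂ p ∘ sym)) (contract x π) ≡ π
  back∘forth π (((inv , _) , _) , ¬fix) _ =
    TranspositionInsertion.determines-π (insertTransposition-inserts x (InsertsTransposition.fixes-y r)) r
    where r = contract-transposition π inv (¬fix ∘ sym)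

count-moving : (x : Fin (suc (suc n))) {S : Subset (suc (suc n))} {N : ℕ} → (∀ π → Inverts π S → lookup π x ∉ S) →
  (∀ y → y ∉ removeAt S x → Involutions k (removeAt (removeAt S x) y) ↔ Fin N) →
  Subtype (λ π → involutionInverting? (2 + k) S π ×-dec ¬? (lookup π x ≟ x)) ↔ Fin ((suc n ∸ ∣ removeAt S x ∣) * N)
count-moving x {S} πx∉S fibre =
  remove-moved-point x πx∉S
  ⟨↔⟩ Σ-↔ ↔-refl (λ { {y , y∉} → remove-fixed-point y (toWitness y∉) ⟨↔⟩ fibre y (toWitness y∉) })
  ⟨↔⟩ (∁-count (removeAt S x) ×-↔ ↔-refl)
  ⟨↔⟩ ↔-sym *↔×

half-suc-suc : ∀ m → suc (suc m) / 2 ≡ suc (m / 2)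
half-suc-suc m = m/n≡1+[m∸n]/n {suc (suc m)} {2} (s≤s (s≤s z≤n))

twice-half-suc-suc : ∀ m → 2 * (suc (suc m) / 2) ≡ 2 + 2 * (m / 2)
twice-half-suc-suc m = trans (cong (2 *_) (half-suc-suc m)) (*-suc 2 (m / 2))

twice-half-even : ∀ m → parity m ≡ 0ℙ → 2 * (m / 2) ≡ m
twice-half-even 0             _ = refl
twice-half-even (suc (suc m)) p = trans (twice-half-suc-suc m) (cong (2 +_) (twice-half-even m p))

twice-half-odd : ∀ m → parity m ≡ 1ℙ → suc (2 * (m / 2)) ≡ m
twice-half-odd 1             _ = refl
twice-half-odd (suc (suc m)) p = trans (cong suc (twice-half-suc-suc m)) (cong (2 +_) (twice-half-odd m p))

half-suc-odd : ∀ m → parity m ≡ 1ℙ → suc m / 2 ≡ suc (m / 2)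
half-suc-odd 1             _ = refl
half-suc-odd (suc (suc m)) p = trans (half-suc-suc (suc m)) (cong suc (trans (half-suc-odd m p) (sym (half-suc-suc m))))

2*suc-≤ : ∀ {i m} → 2 * suc i ≤ 2 + m → 2 * i ≤ m
2*suc-≤ {i} {m} h = +-cancelˡ-≤ 2 (2 * i) m (subst (_≤ 2 + m) (*-suc 2 i) h)

ifOdd : Parity → ℕ → ℕ
ifOdd 0ℙ _ = 0
ifOdd 1ℙ k = k

-- The first of m + 2 points is paired with one of the other m + 1, or, only if m + 2 is odd, fixed.
simpleCount : ℕ → ℕ
simpleCount 0             = 1
simpleCount 1             = 1
simpleCount (suc (suc m)) = suc m * simpleCount m + ifOdd (parity m) (simpleCount (suc m))

simpleCount-step : ∀ m → simpleCount m * (2 ^ (m / 2) * (m / 2) !) ≡ m ! →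
  simpleCount (suc m) * (2 ^ (suc m / 2) * (suc m / 2) !) ≡ suc m ! →
  simpleCount (suc (suc m)) * (2 ^ suc (m / 2) * suc (m / 2) !) ≡ suc (suc m) !
simpleCount-step m ih ih′ with parity m in p
... | 0ℙ = begin
  (suc m * simpleCount m + 0) * (2 * 2 ^ h * (suc h * h !))
    ≡⟨ rearrange (suc m) (simpleCount m) (2 ^ h) (h !) (suc h) ⟩
  suc m * (2 * suc h) * (simpleCount m * (2 ^ h * h !))
    ≡⟨ cong₂ (λ t u → suc m * t * u) 2[1+h]≡2+m ih ⟩
  suc m * suc (suc m) * m !
    ≡⟨ swap (suc m) (suc (suc m)) (m !) ⟩
  suc (suc m) !
    ∎
  where
  open ≡-Reasoning
  h = m / 2
  2[1+h]≡2+m : 2 * suc h ≡ suc (suc m)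
  2[1+h]≡2+m = trans (*-suc 2 h) (cong (2 +_) (twice-half-even m p))
  rearrange : ∀ a e P F s → (a * e + 0) * (2 * P * (s * F)) ≡ a * (2 * s) * (e * (P * F))
  rearrange = solve-∀
  swap : ∀ a b c → a * b * c ≡ b * (a * c)
  swap = solve-∀
... | 1ℙ = begin
  (suc m * simpleCount m + simpleCount (suc m)) * (2 * 2 ^ h * (suc h * h !))
    ≡⟨ rearrange (suc m) (simpleCount m) (simpleCount (suc m)) (2 ^ h) (h !) (suc h) ⟩
  suc m * (2 * suc h) * (simpleCount m * (2 ^ h * h !)) + simpleCount (suc m) * (2 ^ suc h * suc h !)
    ≡⟨ cong₂ _+_ (cong₂ (λ t u → suc m * t * u) 2[1+h]≡1+m ih) ih″ ⟩
  suc m * suc m * m ! + suc m !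
    ≡⟨ collect (suc m) (m !) ⟩
  suc (suc m) !
    ∎
  where
  open ≡-Reasoning
  h = m / 2
  2[1+h]≡1+m : 2 * suc h ≡ suc m
  2[1+h]≡1+m = trans (*-suc 2 h) (cong suc (twice-half-odd m p))
  ih″ : simpleCount (suc m) * (2 ^ suc h * suc h !) ≡ suc m !
  ih″ = subst (λ k → simpleCount (suc m) * (2 ^ k * k !) ≡ suc m !) (half-suc-odd m p) ih′
  rearrange : ∀ a e e′ P F s → (a * e + e′) * (2 * P * (s * F)) ≡ a * (2 * s) * (e * (P * F)) + e′ * (2 * P * (s * F))
  rearrange = solve-∀
  collect : ∀ a f → a * a * f + a * f ≡ suc a * (a * f)
  collect = solve-∀

simpleCount-closed : ∀ n → simpleCount n * (2 ^ (n / 2) * (n / 2) !) ≡ n !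
simpleCount-closed 0             = refl
simpleCount-closed 1             = refl
simpleCount-closed (suc (suc m)) =
  subst (λ k → simpleCount (suc (suc m)) * (2 ^ k * k !) ≡ suc (suc m) !) (sym (half-suc-suc m))
    (simpleCount-step m (simpleCount-closed m) (simpleCount-closed (suc m)))

-- A point of S is paired with one of the (m + 2) − (i + 1) points outside S. The last clause is
-- excluded by 2 * i ≤ n.
simpleInvertingCount : ℕ → ℕ → ℕ
simpleInvertingCount n             zero    = simpleCount n
simpleInvertingCount (suc (suc m)) (suc i) = (suc m ∸ i) * simpleInvertingCount m i
simpleInvertingCount _             (suc _) = 0

simpleInvertingCount-closed : ∀ n i → 2 * i ≤ n →
  simpleInvertingCount n i * (2 ^ (n / 2 ∸ i) * (n / 2 ∸ i) !) ≡ (n ∸ i) !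
simpleInvertingCount-closed n zero _ = simpleCount-closed n
simpleInvertingCount-closed (suc zero) (suc zero) (s≤s ())
simpleInvertingCount-closed (suc zero) (suc (suc i)) (s≤s ())
simpleInvertingCount-closed (suc (suc m)) (suc i) 2[1+i]≤2+m rewrite half-suc-suc m = begin
  (suc m ∸ i) * simpleInvertingCount m i * (2 ^ (m / 2 ∸ i) * (m / 2 ∸ i) !)
    ≡⟨ *-assoc (suc m ∸ i) _ _ ⟩
  (suc m ∸ i) * (simpleInvertingCount m i * (2 ^ (m / 2 ∸ i) * (m / 2 ∸ i) !))
    ≡⟨ cong ((suc m ∸ i) *_) (simpleInvertingCount-closed m i 2i≤m) ⟩
  (suc m ∸ i) * (m ∸ i) !
    ≡⟨ cong (_* (m ∸ i) !) 1+m∸i≡1+[m∸i] ⟩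
  suc (m ∸ i) !
    ≡⟨ cong _! 1+m∸i≡1+[m∸i] ⟨
  (suc m ∸ i) !
    ∎
  where
  open ≡-Reasoning
  2i≤m : 2 * i ≤ m
  2i≤m = 2*suc-≤ 2[1+i]≤2+m
  1+m∸i≡1+[m∸i] : suc m ∸ i ≡ suc (m ∸ i)
  1+m∸i≡1+[m∸i] = +-∸-assoc 1 (≤-trans (m≤n*m i 2) 2i≤m)

SimpleInverting : Subset n → Set
SimpleInverting {n} S = Involutions (2 * (n / 2)) S

-- 2 + 2 * (m / 2) exceeds m + 1 for even m and equals 2 * ((m + 1) / 2) for odd m.
simple-or-empty : ∀ m {N} → SimpleInverting (⊥ {suc m}) ↔ Fin N →
  Involutions (2 + 2 * (m / 2)) (⊥ {suc m}) ↔ Fin (ifOdd (parity m) N)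
simple-or-empty m simple with parity m in p
... | 0ℙ = Involutions-empty (≤-reflexive (cong (2 +_) (sym (twice-half-even m p))))
... | 1ℙ = K-reflexive (cong (λ k → Involutions k (⊥ {suc m})) 2+2⌊m/2⌋≡2⌊[m+1]/2⌋) ⟨↔⟩ simple
  where
  2+2⌊m/2⌋≡2⌊[m+1]/2⌋ : 2 + 2 * (m / 2) ≡ 2 * (suc m / 2)
  2+2⌊m/2⌋≡2⌊[m+1]/2⌋ = sym (trans (cong (2 *_) (half-suc-odd m p)) (*-suc 2 (m / 2)))

simple-count : ∀ n → SimpleInverting (⊥ {n}) ↔ Fin (simpleCount n)
simple-count 0 = Subtype-unique (involutionInverting? 0 ⊥) [] (((λ ()) , refl) , λ ()) λ { [] → refl }
simple-count 1 =
  Subtype-unique (involutionInverting? 0 ⊥) (zero ∷ []) (((λ { zero → refl }) , refl) , λ { zero () }) λ { (zero ∷ []) → refl }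
simple-count (suc (suc m)) =
  K-reflexive (cong (λ k → Involutions k (⊥ {suc (suc m)})) (twice-half-suc-suc m))
  ⟨↔⟩ Subtype-split _ (λ π → lookup π zero ≟ zero)
  ⟨↔⟩ (moving ⊎-↔ (remove-fixed-point zero ∉⊥ ⟨↔⟩ simple-or-empty m (simple-count (suc m))))
  ⟨↔⟩ ↔-sym +↔⊎
  where
  moving : Subtype (λ π → involutionInverting? (2 + 2 * (m / 2)) ⊥ π ×-dec ¬? (lookup π zero ≟ zero))
             ↔ Fin (suc m * simpleCount m)
  moving =
    count-moving zero (λ _ _ → ∉⊥) (λ y _ → K-reflexive (cong (Involutions _) (removeAt-⊥ y)) ⟨↔⟩ simple-count m)
    ⟨↔⟩ Fin-cong (cong (λ i → (suc m ∸ i) * simpleCount m) (∣⊥∣≡0 (suc m)))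

simpleInverting-count : ∀ n (S : Subset n) → 2 * ∣ S ∣ ≤ n → SimpleInverting S ↔ Fin (simpleInvertingCount n ∣ S ∣)
simpleInverting-count-∈ : ∀ n (S : Subset n) {x} → x ∈ S → 2 * ∣ S ∣ ≤ n →
  SimpleInverting S ↔ Fin (simpleInvertingCount n ∣ S ∣)

simpleInverting-count n S 2∣S∣≤n with nonempty? S
... | yes (x , x∈S) = simpleInverting-count-∈ n S x∈S 2∣S∣≤n
... | no ∄x with refl ← Empty-unique ∄x =
  simple-count n ⟨↔⟩ Fin-cong (cong (simpleInvertingCount n) (sym (∣⊥∣≡0 n)))

simpleInverting-count-∈ (suc zero) (inside ∷ []) here (s≤s ())
simpleInverting-count-∈ (suc (suc m)) S {x} x∈S 2∣S∣≤n =
  K-reflexive (cong (λ k → Involutions k S) (twice-half-suc-suc m))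
  ⟨↔⟩ Subtype-⇔ _ _ (λ π p → p , x-moved π p) (λ _ → proj₁)
  ⟨↔⟩ count-moving x (λ π inverts → inverts x x∈S) fibre
  ⟨↔⟩ Fin-cong (cong (simpleInvertingCount (suc (suc m))) (sym ∣S∣≡1+∣S′∣))
  where
  S′ = removeAt S x
  ∣S∣≡1+∣S′∣ : ∣ S ∣ ≡ suc ∣ S′ ∣
  ∣S∣≡1+∣S′∣ = ∣removeAt∣-∈ x∈S
  x-moved : ∀ π → InvolutionInverting (2 + 2 * (m / 2)) S π → lookup π x ≢ x
  x-moved π (_ , inverts) πx≡x = inverts x x∈S (subst (_∈ S) (sym πx≡x) x∈S)
  fibre : ∀ y → y ∉ S′ → Involutions (2 * (m / 2)) (removeAt S′ y) ↔ Fin (simpleInvertingCount m ∣ S′ ∣)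
  fibre y y∉S′ =
    simpleInverting-count m S″ 2∣S″∣≤m ⟨↔⟩ Fin-cong (cong (simpleInvertingCount m) (sym ∣S′∣≡∣S″∣))
    where
    S″ = removeAt S′ y
    ∣S′∣≡∣S″∣ : ∣ S′ ∣ ≡ ∣ S″ ∣
    ∣S′∣≡∣S″∣ = ∣removeAt∣-∉ y∉S′
    2∣S″∣≤m : 2 * ∣ S″ ∣ ≤ m
    2∣S″∣≤m = 2*suc-≤ (subst (λ i → 2 * i ≤ suc (suc m)) (trans ∣S∣≡1+∣S′∣ (cong suc ∣S′∣≡∣S″∣)) 2∣S∣≤n)

numSimpleInverting≡simpleInvertingCount : ∀ n (S : Subset n) → 2 * ∣ S ∣ ≤ n →
  numSimpleInverting n S ≡ simpleInvertingCount n ∣ S ∣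
numSimpleInverting≡simpleInvertingCount n S 2∣S∣≤n =
  Fin-injective (count-tables n n (λ π → isSimple? π ×-dec inverts? π S) ⟨↔⟩ simpleInverting-count n S 2∣S∣≤n)

lemma2p2 : (n : ℕ) (S : Subset n) → 2 * ∣ S ∣ ≤ n →
    numSimpleInverting n S * (2 ^ (n / 2 ∸ ∣ S ∣) * ((n / 2 ∸ ∣ S ∣) !)) ≡ (n ∸ ∣ S ∣) !
lemma2p2 n S 2∣S∣≤n = begin
  numSimpleInverting n S * (2 ^ (n / 2 ∸ ∣ S ∣) * (n / 2 ∸ ∣ S ∣) !)
    ≡⟨ cong (_* (2 ^ (n / 2 ∸ ∣ S ∣) * (n / 2 ∸ ∣ S ∣) !)) (numSimpleInverting≡simpleInvertingCount n S 2∣S∣≤n) ⟩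
  simpleInvertingCount n ∣ S ∣ * (2 ^ (n / 2 ∸ ∣ S ∣) * (n / 2 ∸ ∣ S ∣) !)
    ≡⟨ simpleInvertingCount-closed n ∣ S ∣ 2∣S∣≤n ⟩
  (n ∸ ∣ S ∣) !
    ∎
  where open ≡-Reasoning
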